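{- Let $\mathcal{H}$ be an $n$-vertex linear hypergraph and let $\{A, B\}$ be a partition of its edge set such that $|A| + |B| - n \leq |A|/4$. If for every two distinct intersecting edges $e, f \in A$ the pair $\{e,f\}$ is useful, then $\mathcal{H}$ has a proper edge-colouring with $n$ colours in which each colour is assigned to at most two edges.
   Context: A hypergraph has a finite vertex set and a set of (non-repeated) nonempty subsets as edges; it is linear if distinct edges share at most one vertex. For an edge $e$, $N(e)$ denotes the set of edges $f \ne e$ with $f \cap e \neq \varnothing$. In an $n$-vertex hypergraph, a pair $\{e,f\}$ of edges is useful if $e \ne f$, $e \cap f \ne \varnothing$, and $|N(e) \cap N(f)| \le n-2$. A proper edge-colouring gives intersecting distinct edges different colours. -}

module Defs where

open import Data.Nat using (ℕ; _≤_; _+_; _*_)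
open import Data.Fin using (Fin)
open import Data.Fin.Properties using (_≟_)
open import Data.Fin.Subset using (Subset; _∩_; Nonempty; _∈_; _∉_; ∣_∣)
open import Data.Fin.Subset.Properties using (nonempty?)
open import Data.List using (List; length; filter; allFin)
open import Data.Product using (_×_)
open import Relation.Nullary using (¬_; Dec; _×-dec_; ¬?)
open import Relation.Unary using (Decidable)
open import Relation.Binary.PropositionalEquality using (_≡_; _≢_)

count : ∀ {m} {P : Fin m → Set} → Decidable P → ℕ
count {m} P? = length (filter P? (allFin m))

record Hypergraph (n : ℕ) : Set where
  field
    m         : ℕ
    edge      : Fin m → Subset n
    nonempty  : ∀ i → Nonempty (edge i)
    distinct  : ∀ i j → edge i ≡ edge j → i ≡ j

open Hypergraph public

module _ {n : ℕ} (H : Hypergraph n) where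

  Meet : Fin (m H) → Fin (m H) → Set
  Meet e f = Nonempty (edge H e ∩ edge H f)

  meet? : ∀ e f → Dec (Meet e f)
  meet? e f = nonempty? (edge H e ∩ edge H f)

  Linear : Set
  Linear = ∀ e f → e ≢ f → ∣ edge H e ∩ edge H f ∣ ≤ 1

  InN : Fin (m H) → Fin (m H) → Set
  InN e g = (g ≢ e) × Meet g e

  inN? : ∀ e g → Dec (InN e g)
  inN? e g = ¬? (g ≟ e) ×-dec meet? g e

  commonNbrs : Fin (m H) → Fin (m H) → ℕ
  commonNbrs e f = count (λ g → inN? e g ×-dec inN? f g)

  -- {e,f} useful: e ≠ f, e ∩ f ≠ ∅, |N(e) ∩ N(f)| ≤ n - 2
  -- (written  |N(e) ∩ N(f)| + 2 ≤ n  to avoid truncated subtraction)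
  Useful : Fin (m H) → Fin (m H) → Set
  Useful e f = (e ≢ f) × Meet e f × (commonNbrs e f + 2 ≤ n)

  ProperColouring : (Fin (m H) → Fin n) → Set
  ProperColouring c = ∀ e f → e ≢ f → Meet e f → c e ≢ c f

  AtMostTwoPerColour : (Fin (m H) → Fin n) → Set
  AtMostTwoPerColour c = ∀ (k : Fin n) → count (λ e → c e ≟ k) ≤ 2

-- A colouring with at most two edges per colour class is the same as a matching in
-- the disjointness graph of the edges: a matching with W matched edges gives m − W/2 classes,
-- one per orbit of the matching viewed as an involution.  Starting from the empty matching we
-- enlarge it while it has more than n orbits.  The bound on |A| then leaves four unmatched edges
-- x₀,…,x₃ in A.  If an unmatched edge misses some xᵢ we add that pair; if a matched pair {g, g′}
-- has g missing xᵢ and g′ missing xⱼ with i ≠ j we augment along xᵢ g g′ xⱼ.  Otherwise the xᵢ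
-- pairwise intersect, so each of the six pairs {xᵢ, xⱼ} is useful and at least m − n edges miss
-- xᵢ or xⱼ.  Summed over the six pairs this is at least 6(m − n); but all these edges are matched
-- and a matched pair {g, g′} contributes at most 6, because the sets of xᵢ missed by g and by g′
-- are empty or the same singleton.  Hence 6(m − n) ≤ 3W, i.e. there are at most n orbits.
module Submission where

open import Defs
open import Data.Nat using (ℕ; _≤_; _+_; _*_)
open import Data.Fin using (Fin)
open import Data.Fin.Subset using (Subset; _∈_; ∣_∣)
open import Data.Product using (Σ; _×_)
open import Relation.Binary.PropositionalEquality using (_≢_)

open import Data.Bool using (true; false; if_then_else_)
open import Data.Empty using (⊥; ⊥-elim)
open import Data.Fin using (zero; suc; inject≤) renaming (_<_ to _<ᶠ_; _≤_ to _≤ᶠ_)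
open import Data.Fin.Patterns using (0F; 1F; 2F; 3F; 4F; 5F)
open import Data.Fin.Permutation using (permutation)
open import Data.Fin.Properties using (_≟_; _≤?_; any?; <-cmp; inject≤-injective)
open import Data.Fin.Subset using (Nonempty)
open import Data.Fin.Subset.Properties using (_∈?_; x∈p∩q⁺; ∩-comm)
open import Data.List using (List; length; filter; allFin; tabulate; lookup)
open import Data.List.Membership.Propositional.Properties using (∈-lookup; ∈-filter⁺; ∈-filter⁻; ∈-allFin)
open import Data.List.Relation.Unary.All as All using ()
open import Data.List.Relation.Unary.AllPairs using (_∷_)
open import Data.List.Relation.Unary.Any using (index)
open import Data.List.Relation.Unary.Any.Properties using (lookup-index)
open import Data.List.Relation.Unary.Unique.Propositional using (Unique)
import Data.List.Relation.Unary.Unique.Propositional.Properties as Unique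
open import Data.Nat using (zero; suc; _<_; z≤n; s≤s)
import Data.Nat.Properties as ℕ
open import Data.Nat.Tactic.RingSolver using (solve-∀)
open import Algebra.Properties.Semiring.Sum ℕ.+-*-semiring
  using (sum; sum-cong-≗; sum-permute; ∑-distrib-+; ∑-comm; *-distribˡ-sum)
open import Data.Product using (_,_; proj₁; proj₂; Σ-syntax; ∃)
open import Data.Sum using (_⊎_; inj₁; inj₂; [_,_]′)
import Data.Sum as ⊎
open import Data.Vec using ([]; _∷_)
open import Function using (_∘_)
open import Level using (Level)
open import Relation.Binary using (Tri; tri<; tri≈; tri>)
open import Relation.Binary.PropositionalEquality
  using (_≡_; refl; sym; trans; cong; cong₂; subst; module ≡-Reasoning)
open import Relation.Nullary using (Dec; yes; no; does; ¬_; ¬?; _⊎-dec_; _×-dec_)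
open import Relation.Nullary.Decidable using (decidable-stable)
open import Relation.Unary using (Pred; Decidable)

private
  variable
    ℓ₁ ℓ₂ : Level
    P : Set ℓ₁
    Q : Set ℓ₂

𝟙 : Dec P → ℕ
𝟙 d = if does d then 1 else 0

𝟙-yes : (d : Dec P) → P → 𝟙 d ≡ 1
𝟙-yes (yes _) _ = refl
𝟙-yes (no ¬p) p = ⊥-elim (¬p p)

𝟙-no : (d : Dec P) → ¬ P → 𝟙 d ≡ 0
𝟙-no (yes p) ¬p = ⊥-elim (¬p p)
𝟙-no (no _)  _  = refl

𝟙≤1 : (d : Dec P) → 𝟙 d ≤ 1
𝟙≤1 (yes _) = ℕ.≤-refl
𝟙≤1 (no _)  = z≤n

𝟙-cong : (d : Dec P) (e : Dec Q) → (P → Q) → (Q → P) → 𝟙 d ≡ 𝟙 e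
𝟙-cong (yes p) e P→Q _ = sym (𝟙-yes e (P→Q p))
𝟙-cong (no ¬p) e _ Q→P = sym (𝟙-no e (¬p ∘ Q→P))

𝟙≤𝟙×+𝟙¬ : (d : Dec P) (e : Dec Q) → 𝟙 d ≤ 𝟙 (d ×-dec e) + 𝟙 (¬? e)
𝟙≤𝟙×+𝟙¬ (yes _) (yes _) = ℕ.≤-refl
𝟙≤𝟙×+𝟙¬ (yes _) (no _)  = ℕ.≤-refl
𝟙≤𝟙×+𝟙¬ (no _)  _       = z≤n

𝟙+𝟙¬≡1 : (d : Dec P) → 𝟙 d + 𝟙 (¬? d) ≡ 1
𝟙+𝟙¬≡1 (yes _) = refl
𝟙+𝟙¬≡1 (no _)  = refl

𝟙≤+𝟙≥ : ∀ {k} (x y : Fin k) → 𝟙 (x ≤? y) + 𝟙 (y ≤? x) ≡ 𝟙 (y ≟ x) + 1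
𝟙≤+𝟙≥ x y = by-cases (<-cmp x y)
  where
  by-cases : Tri (x <ᶠ y) (x ≡ y) (y <ᶠ x) → 𝟙 (x ≤? y) + 𝟙 (y ≤? x) ≡ 𝟙 (y ≟ x) + 1
  by-cases (tri< x<y x≢y _)
    rewrite 𝟙-yes (x ≤? y) (ℕ.<⇒≤ x<y) | 𝟙-no (y ≤? x) (ℕ.<⇒≱ x<y) | 𝟙-no (y ≟ x) (x≢y ∘ sym) = refl
  by-cases (tri≈ _ refl _)
    rewrite 𝟙-yes (x ≤? x) ℕ.≤-refl | 𝟙-yes (x ≟ x) refl = refl
  by-cases (tri> _ x≢y y<x)
    rewrite 𝟙-no (x ≤? y) (ℕ.<⇒≱ y<x) | 𝟙-yes (y ≤? x) (ℕ.<⇒≤ y<x) | 𝟙-no (y ≟ x) (x≢y ∘ sym) = refl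

∑-mono : ∀ {k} {f g : Fin k → ℕ} → (∀ i → f i ≤ g i) → sum f ≤ sum g
∑-mono {zero}  _   = z≤n
∑-mono {suc k} f≤g = ℕ.+-mono-≤ (f≤g zero) (∑-mono (f≤g ∘ suc))

∑-const : ∀ k c → sum {k} (λ _ → c) ≡ k * c
∑-const zero    c = refl
∑-const (suc k) c = cong (c +_) (∑-const k c)

∑-one : ∀ k → sum {k} (λ _ → 1) ≡ k
∑-one k = trans (∑-const k 1) (ℕ.*-identityʳ k)

∑-𝟙≟ : ∀ {k} (a : Fin k) → sum (λ i → 𝟙 (i ≟ a)) ≡ 1
∑-𝟙≟ {suc k} zero    = cong suc (trans (∑-const k 0) (ℕ.*-zeroʳ k))
∑-𝟙≟ {suc k} (suc a) = ∑-𝟙≟ a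

∑-∘-involution : ∀ {k} {p : Fin k → Fin k} → (∀ i → p (p i) ≡ i) →
                 (f : Fin k → ℕ) → sum (f ∘ p) ≡ sum f
∑-∘-involution {p = p} inv f = sym (sum-permute f (permutation p p inv inv))

∑-raise₂ : ∀ {k} {f g : Fin k → ℕ} {a b : Fin k} → a ≢ b →
           f a ≡ 0 → f b ≡ 0 → g a ≡ 1 → g b ≡ 1 →
           (∀ i → i ≢ a → i ≢ b → g i ≡ f i) → sum g ≡ 2 + sum f
∑-raise₂ {f = f} {g} {a} {b} a≢b fa fb ga gb g≡f = begin
  sum g                                       ≡⟨ sum-cong-≗ pointwise ⟩
  sum (λ i → f i + 𝟙 (i ≟ a) + 𝟙 (i ≟ b))     ≡⟨ ∑-distrib-+ (λ i → f i + 𝟙 (i ≟ a)) _ ⟩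
  sum (λ i → f i + 𝟙 (i ≟ a)) + sum (λ i → 𝟙 (i ≟ b))
    ≡⟨ cong₂ _+_ (trans (∑-distrib-+ f _) (cong (sum f +_) (∑-𝟙≟ a))) (∑-𝟙≟ b) ⟩
  sum f + 1 + 1                               ≡⟨ ℕ.+-comm (sum f + 1) 1 ⟩
  suc (sum f + 1)                             ≡⟨ cong suc (ℕ.+-comm (sum f) 1) ⟩
  2 + sum f                                   ∎
  where
  open ≡-Reasoning
  pointwise : ∀ i → g i ≡ f i + 𝟙 (i ≟ a) + 𝟙 (i ≟ b)
  pointwise i with i ≟ a | i ≟ b
  ... | yes refl | yes refl = ⊥-elim (a≢b refl)
  ... | yes refl | no _     = trans ga (cong (λ z → z + 1 + 0) (sym fa))
  ... | no _     | yes refl = trans gb (cong (λ z → z + 0 + 1) (sym fb))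
  ... | no i≢a   | no i≢b   = trans (g≡f i i≢a i≢b) (sym (trans (ℕ.+-identityʳ _) (ℕ.+-identityʳ _)))

∑-𝟙-empty : ∀ {k} {P : Pred (Fin k) ℓ₁} (P? : Decidable P) → (∀ i → ¬ P i) → sum (λ i → 𝟙 (P? i)) ≡ 0
∑-𝟙-empty {k = k} P? ∄P = trans (sum-cong-≗ (λ i → 𝟙-no (P? i) (∄P i))) (trans (∑-const k 0) (ℕ.*-zeroʳ k))

∑-𝟙≤2 : ∀ {k} {P : Pred (Fin k) ℓ₁} (P? : Decidable P) {x y : Fin k} →
        (∀ i → P i → i ≡ x ⊎ i ≡ y) → sum (λ i → 𝟙 (P? i)) ≤ 2
∑-𝟙≤2 P? {x} {y} P⊆xy = begin
  sum (λ i → 𝟙 (P? i))                        ≤⟨ ∑-mono pointwise ⟩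
  sum (λ i → 𝟙 (i ≟ x) + 𝟙 (i ≟ y))          ≡⟨ ∑-distrib-+ (λ i → 𝟙 (i ≟ x)) (λ i → 𝟙 (i ≟ y)) ⟩
  sum (λ i → 𝟙 (i ≟ x)) + sum (λ i → 𝟙 (i ≟ y)) ≡⟨ cong₂ _+_ (∑-𝟙≟ x) (∑-𝟙≟ y) ⟩
  2                                           ∎
  where
  open ℕ.≤-Reasoning
  pointwise : ∀ i → 𝟙 (P? i) ≤ 𝟙 (i ≟ x) + 𝟙 (i ≟ y)
  pointwise i with P? i
  ... | no _ = z≤n
  ... | yes Pi with P⊆xy i Pi
  ...   | inj₁ refl = ℕ.≤-trans (ℕ.≤-reflexive (sym (𝟙-yes (i ≟ i) refl))) (ℕ.m≤m+n _ _)
  ...   | inj₂ refl = ℕ.≤-trans (ℕ.≤-reflexive (sym (𝟙-yes (i ≟ i) refl))) (ℕ.m≤n+m _ _)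

length-filter-tabulate : ∀ {k} {A : Set ℓ₁} {P : Pred A ℓ₂} (P? : Decidable P) (f : Fin k → A) →
                         length (filter P? (tabulate f)) ≡ sum (λ i → 𝟙 (P? (f i)))
length-filter-tabulate {k = zero}  P? f = refl
length-filter-tabulate {k = suc k} P? f with does (P? (f zero))
... | true  = cong suc (length-filter-tabulate P? (f ∘ suc))
... | false = length-filter-tabulate P? (f ∘ suc)

count≡∑𝟙 : ∀ {k} {P : Fin k → Set} (P? : Decidable P) → count P? ≡ sum (λ i → 𝟙 (P? i))
count≡∑𝟙 P? = length-filter-tabulate P? (λ i → i)

∣p∣≡∑𝟙 : ∀ {k} (p : Subset k) → ∣ p ∣ ≡ sum (λ i → 𝟙 (i ∈? p))
∣p∣≡∑𝟙 []          = refl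
∣p∣≡∑𝟙 (true ∷ p)  = cong suc (∣p∣≡∑𝟙 p)
∣p∣≡∑𝟙 (false ∷ p) = ∣p∣≡∑𝟙 p

lookup-injective : ∀ {A : Set ℓ₁} {xs : List A} → Unique xs → ∀ i j → lookup xs i ≡ lookup xs j → i ≡ j
lookup-injective (_   ∷ _) zero    zero    _  = refl
lookup-injective (x∉ ∷ _) zero    (suc j) eq = ⊥-elim (All.lookup x∉ (∈-lookup j) eq)
lookup-injective (x∉ ∷ _) (suc i) zero    eq = ⊥-elim (All.lookup x∉ (∈-lookup i) (sym eq))
lookup-injective (_   ∷ u) (suc i) (suc j) eq = cong suc (lookup-injective u i j eq)

distinct-witnesses : ∀ {k r} {P : Fin k → Set} (P? : Decidable P) → r ≤ count P? →
                     Σ (Fin r → Fin k) λ x → (∀ i → P (x i)) × (∀ i j → x i ≡ x j → i ≡ j)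
distinct-witnesses {k} {r} P? r≤ = x , (λ i → proj₂ (∈-filter⁻ P? {xs = allFin k} (∈-lookup _))) , injective
  where
  x : Fin r → Fin k
  x i = lookup (filter P? (allFin k)) (inject≤ i r≤)
  injective : ∀ i j → x i ≡ x j → i ≡ j
  injective i j eq = inject≤-injective r≤ r≤ i j
    (lookup-injective (Unique.filter⁺ P? (Unique.allFin⁺ k)) _ _ eq)

-- Involutions of Fin k and their orbits

module _ {k : ℕ} where

  unmatched matched orbits : (Fin k → Fin k) → ℕ
  unmatched p = sum (λ e → 𝟙 (p e ≟ e))
  matched   p = sum (λ e → 𝟙 (¬? (p e ≟ e)))
  -- For an involution p, each orbit {e, p e} is counted once, at its least element.
  orbits    p = sum (λ e → 𝟙 (e ≤? p e))

  unmatched+matched : ∀ p → unmatched p + matched p ≡ k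
  unmatched+matched p = begin
    unmatched p + matched p                     ≡⟨ ∑-distrib-+ (λ e → 𝟙 (p e ≟ e)) (λ e → 𝟙 (¬? (p e ≟ e))) ⟨
    sum (λ e → 𝟙 (p e ≟ e) + 𝟙 (¬? (p e ≟ e)))  ≡⟨ sum-cong-≗ (λ e → 𝟙+𝟙¬≡1 (p e ≟ e)) ⟩
    sum {k} (λ _ → 1)                           ≡⟨ ∑-one k ⟩
    k                                           ∎
    where open ≡-Reasoning

  matched≤k : ∀ p → matched p ≤ k
  matched≤k p = ℕ.≤-trans (ℕ.m≤n+m _ (unmatched p)) (ℕ.≤-reflexive (unmatched+matched p))

  orbits+orbits : ∀ {p} → (∀ e → p (p e) ≡ e) → orbits p + orbits p ≡ unmatched p + k
  orbits+orbits {p} inv = begin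
    orbits p + orbits p                       ≡⟨ cong (orbits p +_) (trans
                                                   (sym (∑-∘-involution {p = p} inv (λ e → 𝟙 (e ≤? p e))))
                                                   (sum-cong-≗ (λ e → cong (λ z → 𝟙 (p e ≤? z)) (inv e)))) ⟩
    orbits p + sum (λ e → 𝟙 (p e ≤? e))       ≡⟨ ∑-distrib-+ (λ e → 𝟙 (e ≤? p e)) (λ e → 𝟙 (p e ≤? e)) ⟨
    sum (λ e → 𝟙 (e ≤? p e) + 𝟙 (p e ≤? e))   ≡⟨ sum-cong-≗ (λ e → 𝟙≤+𝟙≥ e (p e)) ⟩
    sum (λ e → 𝟙 (p e ≟ e) + 1)               ≡⟨ ∑-distrib-+ (λ e → 𝟙 (p e ≟ e)) (λ _ → 1) ⟩
    unmatched p + sum {k} (λ _ → 1)           ≡⟨ cong (unmatched p +_) (∑-one k) ⟩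
    unmatched p + k                           ∎
    where open ≡-Reasoning

  orbits-double : ∀ {p} → (∀ e → p (p e) ≡ e) → orbits p + orbits p + matched p ≡ k + k
  orbits-double {p} inv = begin
    orbits p + orbits p + matched p  ≡⟨ cong (_+ matched p) (orbits+orbits inv) ⟩
    unmatched p + k + matched p      ≡⟨ swap (unmatched p) k (matched p) ⟩
    unmatched p + matched p + k      ≡⟨ cong (_+ k) (unmatched+matched p) ⟩
    k + k                            ∎
    where
    open ≡-Reasoning
    swap : ∀ u k w → u + k + w ≡ u + w + k
    swap = solve-∀

module _ {k : ℕ} {p : Fin k → Fin k} (inv : ∀ e → p (p e) ≡ e) where

  private
    representative : ∀ e → Σ[ r ∈ Fin k ] (r ≤ᶠ p r × (e ≡ r ⊎ e ≡ p r))
    representative e = pick (e ≤? p e)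
      where
      pick : Dec (e ≤ᶠ p e) → Σ[ r ∈ Fin k ] (r ≤ᶠ p r × (e ≡ r ⊎ e ≡ p r))
      pick (yes e≤pe) = e , e≤pe , inj₁ refl
      pick (no e≰pe)  = p e , subst (p e ≤ᶠ_) (sym (inv e)) (ℕ.<⇒≤ (ℕ.≰⇒> e≰pe)) , inj₂ (sym (inv e))

    rep : Fin k → Fin k
    rep = proj₁ ∘ representative

    same-rep : ∀ e f → rep e ≡ rep f → f ≡ e ⊎ f ≡ p e
    same-rep e f eq with proj₂ (proj₂ (representative e)) | proj₂ (proj₂ (representative f))
    ... | inj₁ e≡r | inj₁ f≡r = inj₁ (trans f≡r (trans (sym eq) (sym e≡r)))
    ... | inj₁ e≡r | inj₂ f≡pr = inj₂ (trans f≡pr (cong p (trans (sym eq) (sym e≡r))))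
    ... | inj₂ e≡pr | inj₁ f≡r = inj₂ (trans f≡r (trans (sym eq) (sym (trans (cong p e≡pr) (inv (rep e))))))
    ... | inj₂ e≡pr | inj₂ f≡pr = inj₁ (trans f≡pr (trans (cong p (sym eq)) (sym e≡pr)))

  -- Colour an orbit by the position of its least element among all such least elements.
  orbit-colouring : ∀ {n} → orbits p ≤ n → Σ[ c ∈ (Fin k → Fin n) ] (∀ e f → c e ≡ c f → f ≡ e ⊎ f ≡ p e)
  orbit-colouring {n} orbits≤n = colour , λ e f eq → same-rep e f (rep-injective e f eq)
    where
    reps : List (Fin k)
    reps = filter (λ e → e ≤? p e) (allFin k)
    reps≤n : length reps ≤ n
    reps≤n = ℕ.≤-trans (ℕ.≤-reflexive (length-filter-tabulate (λ e → e ≤? p e) (λ e → e))) orbits≤n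
    position : ∀ e → Fin (length reps)
    position e = index (∈-filter⁺ (λ e → e ≤? p e) (∈-allFin (rep e)) (proj₁ (proj₂ (representative e))))
    colour : Fin k → Fin n
    colour e = inject≤ (position e) reps≤n
    rep-injective : ∀ e f → colour e ≡ colour f → rep e ≡ rep f
    rep-injective e f eq = begin
      rep e                         ≡⟨ lookup-index (∈-filter⁺ (λ e → e ≤? p e) (∈-allFin (rep e)) _) ⟩
      lookup reps (position e)      ≡⟨ cong (lookup reps) (inject≤-injective reps≤n reps≤n _ _ eq) ⟩
      lookup reps (position f)      ≡⟨ lookup-index (∈-filter⁺ (λ e → e ≤? p e) (∈-allFin (rep f)) _) ⟨
      rep f                         ∎
      where open ≡-Reasoning

pair : Fin 6 → Fin 4 × Fin 4
pair 0F = 0F , 1F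
pair 1F = 0F , 2F
pair 2F = 0F , 3F
pair 3F = 1F , 2F
pair 4F = 1F , 3F
pair 5F = 2F , 3F

pair-distinct : ∀ t → proj₁ (pair t) ≢ proj₂ (pair t)
pair-distinct 0F ()
pair-distinct 1F ()
pair-distinct 2F ()
pair-distinct 3F ()
pair-distinct 4F ()
pair-distinct 5F ()

module _ {P : Pred (Fin 4) ℓ₁} (P? : Decidable P) where

  pairMeets? : ∀ t → Dec (P (proj₁ (pair t)) ⊎ P (proj₂ (pair t)))
  pairMeets? t = P? (proj₁ (pair t)) ⊎-dec P? (proj₂ (pair t))

  pairsMeeting : ℕ
  pairsMeeting = sum λ t → 𝟙 (pairMeets? t)

  pairsMeeting≤6 : pairsMeeting ≤ 6
  pairsMeeting≤6 = ℕ.≤-trans (∑-mono (λ t → 𝟙≤1 (pairMeets? t))) (ℕ.≤-reflexive (∑-const 6 1))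

  pairsMeeting-empty : (∀ i → ¬ P i) → pairsMeeting ≡ 0
  pairsMeeting-empty ∄P = ∑-𝟙-empty pairMeets? (λ _ → [ ∄P _ , ∄P _ ]′)

  pairsMeeting-singleton : ∀ k → P k → (∀ i → P i → i ≡ k) → pairsMeeting ≡ 3
  pairsMeeting-singleton k Pk P⊆k = trans (sum-cong-≗ (λ t → 𝟙-cong (pairMeets? t)
    (proj₁ (pair t) ≟ k ⊎-dec proj₂ (pair t) ≟ k) (⊎.map (P⊆k _) (P⊆k _)) (⊎.map P∋ P∋))) (three k)
    where
    P∋ : ∀ {i} → i ≡ k → P i
    P∋ refl = Pk
    three : ∀ k → sum (λ t → 𝟙 (proj₁ (pair t) ≟ k ⊎-dec proj₂ (pair t) ≟ k)) ≡ 3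
    three 0F = refl
    three 1F = refl
    three 2F = refl
    three 3F = refl

-- Either P or Q is empty, or both are the same singleton.
pairsMeeting-noCross : {P : Pred (Fin 4) ℓ₁} {Q : Pred (Fin 4) ℓ₂} (P? : Decidable P) (Q? : Decidable Q) →
                       (∀ i j → i ≢ j → P i → Q j → ⊥) → pairsMeeting P? + pairsMeeting Q? ≤ 6
pairsMeeting-noCross {P = P} {Q} P? Q? noCross with any? P? | any? Q?
... | no ∄P | _ = begin
  pairsMeeting P? + pairsMeeting Q?  ≡⟨ cong (_+ pairsMeeting Q?) (pairsMeeting-empty P? (λ i Pi → ∄P (i , Pi))) ⟩
  pairsMeeting Q?                    ≤⟨ pairsMeeting≤6 Q? ⟩
  6                                  ∎
  where open ℕ.≤-Reasoning
... | yes _ | no ∄Q = begin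
  pairsMeeting P? + pairsMeeting Q?  ≡⟨ cong (pairsMeeting P? +_) (pairsMeeting-empty Q? (λ j Qj → ∄Q (j , Qj))) ⟩
  pairsMeeting P? + 0                ≡⟨ ℕ.+-identityʳ _ ⟩
  pairsMeeting P?                    ≤⟨ pairsMeeting≤6 P? ⟩
  6                                  ∎
  where open ℕ.≤-Reasoning
... | yes (k , Pk) | yes (l , Ql) = ℕ.≤-reflexive (cong₂ _+_
  (pairsMeeting-singleton P? k Pk (λ i Pi → trans (only-l i Pi) (sym k≡l)))
  (pairsMeeting-singleton Q? k (subst _ (sym k≡l) Ql) only-k))
  where
  k≡l : k ≡ l
  k≡l = decidable-stable (k ≟ l) (λ k≢l → noCross k l k≢l Pk Ql)
  only-l : ∀ i → P i → i ≡ l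
  only-l i Pi = decidable-stable (i ≟ l) (λ i≢l → noCross i l i≢l Pi Ql)
  only-k : ∀ j → Q j → j ≡ k
  only-k j Qj = sym (decidable-stable (k ≟ j) (λ k≢j → noCross k j k≢j Pk Qj))

-- Matchings, as involutions whose moved points are related by a symmetric relation

module Matching {k : ℕ} {ℓ} (_~_ : Fin k → Fin k → Set ℓ) (~-sym : ∀ {a b} → a ~ b → b ~ a) where

  record IsMatching (p : Fin k → Fin k) : Set ℓ where
    field
      involutive : ∀ e → p (p e) ≡ e
      compatible : ∀ e → p e ≢ e → e ~ p e

  open IsMatching public

  id-isMatching : IsMatching (λ e → e)
  id-isMatching = record { involutive = λ _ → refl ; compatible = λ _ e≢e → ⊥-elim (e≢e refl) }

  Enlargement : (Fin k → Fin k) → Set ℓ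
  Enlargement p = Σ[ q ∈ (Fin k → Fin k) ] (IsMatching q × matched q ≡ 2 + matched p)

  private
    variable
      p : Fin k → Fin k
      a b e : Fin k

    matched-at : ∀ (p : Fin k → Fin k) e → p e ≢ e → 𝟙 (¬? (p e ≟ e)) ≡ 1
    matched-at p e pe≢e = 𝟙-yes (¬? (p e ≟ e)) pe≢e

    unmatched-at : ∀ (p : Fin k → Fin k) e → p e ≡ e → 𝟙 (¬? (p e ≟ e)) ≡ 0
    unmatched-at p e pe≡e = 𝟙-no (¬? (p e ≟ e)) (λ pe≢e → pe≢e pe≡e)

  link : (Fin k → Fin k) → Fin k → Fin k → Fin k → Fin k
  link p a b e with e ≟ a | e ≟ b
  ... | yes _ | _     = b
  ... | no _  | yes _ = a
  ... | no _  | no _  = p e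

  link-at₁ : link p a b a ≡ b
  link-at₁ {a = a} with a ≟ a
  ... | yes _   = refl
  ... | no a≢a  = ⊥-elim (a≢a refl)

  link-at₂ : a ≢ b → link p a b b ≡ a
  link-at₂ {a = a} {b = b} a≢b with b ≟ a | b ≟ b
  ... | yes b≡a | _       = ⊥-elim (a≢b (sym b≡a))
  ... | no _    | yes _   = refl
  ... | no _    | no b≢b  = ⊥-elim (b≢b refl)

  link-other : e ≢ a → e ≢ b → link p a b e ≡ p e
  link-other {e = e} {a = a} {b = b} e≢a e≢b with e ≟ a | e ≟ b
  ... | yes e≡a | _       = ⊥-elim (e≢a e≡a)
  ... | no _    | yes e≡b = ⊥-elim (e≢b e≡b)
  ... | no _    | no _    = refl

  link-isMatching : IsMatching p → p a ≡ a → p b ≡ b → a ≢ b → a ~ b → IsMatching (link p a b)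
  link-isMatching {p} {a} {b} M pa pb a≢b a~b = record { involutive = inv ; compatible = comp }
    where
    q : Fin k → Fin k
    q = link p a b
    p-avoids : ∀ {c e} → p c ≡ c → e ≢ c → p e ≢ c
    p-avoids {c} {e} pc e≢c pe≡c = e≢c (trans (sym (involutive M e)) (trans (cong p pe≡c) pc))
    inv : ∀ e → q (q e) ≡ e
    inv e with e ≟ a | e ≟ b
    ... | yes refl | _        = link-at₂ a≢b
    ... | no _     | yes refl = link-at₁ {p = p} {a = a}
    ... | no e≢a   | no e≢b   = trans (link-other (p-avoids pa e≢a) (p-avoids pb e≢b)) (involutive M e)
    comp : ∀ e → q e ≢ e → e ~ q e
    comp e qe≢e with e ≟ a | e ≟ b
    ... | yes refl | _        = a~b
    ... | no _     | yes refl = ~-sym a~b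
    ... | no _     | no _     = compatible M e qe≢e

  matched-link : p a ≡ a → p b ≡ b → a ≢ b → matched (link p a b) ≡ 2 + matched p
  matched-link {p} {a} {b} pa pb a≢b = ∑-raise₂ a≢b (unmatched-at p a pa) (unmatched-at p b pb)
    (matched-at q a (λ qa≡a → a≢b (trans (sym qa≡a) (link-at₁ {p = p} {a = a}))))
    (matched-at q b (λ qb≡b → a≢b (trans (sym (link-at₂ {p = p} a≢b)) qb≡b)))
    (λ e e≢a e≢b → cong (λ z → 𝟙 (¬? (z ≟ e))) (link-other e≢a e≢b))
    where
    q : Fin k → Fin k
    q = link p a b

  extend : IsMatching p → p a ≡ a → p b ≡ b → a ≢ b → a ~ b → Enlargement p
  extend M pa pb a≢b a~b = link _ _ _ , link-isMatching M pa pb a≢b a~b , matched-link pa pb a≢b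

  unlink : (Fin k → Fin k) → Fin k → Fin k → Fin k
  unlink p a e with e ≟ a | e ≟ p a
  ... | yes _ | _     = e
  ... | no _  | yes _ = e
  ... | no _  | no _  = p e

  unlink-fixes : e ≡ a ⊎ e ≡ p a → unlink p a e ≡ e
  unlink-fixes {e = e} {a = a} {p = p} e∈ with e ≟ a | e ≟ p a
  ... | yes _   | _       = refl
  ... | no _    | yes _   = refl
  ... | no e≢a  | no e≢pa = ⊥-elim ([ e≢a , e≢pa ]′ e∈)

  unlink-other : e ≢ a → e ≢ p a → unlink p a e ≡ p e
  unlink-other {e = e} {a = a} {p = p} e≢a e≢pa with e ≟ a | e ≟ p a
  ... | yes e≡a | _        = ⊥-elim (e≢a e≡a)
  ... | no _    | yes e≡pa = ⊥-elim (e≢pa e≡pa)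
  ... | no _    | no _     = refl

  unlink-isMatching : IsMatching p → IsMatching (unlink p a)
  unlink-isMatching {p} {a} M = record { involutive = inv ; compatible = comp }
    where
    q : Fin k → Fin k
    q = unlink p a
    inv : ∀ e → q (q e) ≡ e
    inv e with e ≟ a | e ≟ p a
    ... | yes refl | _        = unlink-fixes {p = p} (inj₁ refl)
    ... | no _     | yes refl = unlink-fixes {p = p} (inj₂ refl)
    ... | no e≢a   | no e≢pa  = trans (unlink-other pe≢a pe≢pa) (involutive M e)
      where
      pe≢a : p e ≢ a
      pe≢a pe≡a = e≢pa (trans (sym (involutive M e)) (cong p pe≡a))
      pe≢pa : p e ≢ p a
      pe≢pa pe≡pa = e≢a (trans (sym (involutive M e)) (trans (cong p pe≡pa) (involutive M a)))
    comp : ∀ e → q e ≢ e → e ~ q e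
    comp e qe≢e with e ≟ a | e ≟ p a
    ... | yes _ | _     = ⊥-elim (qe≢e refl)
    ... | no _  | yes _ = ⊥-elim (qe≢e refl)
    ... | no _  | no _  = compatible M e qe≢e

  matched-unlink : IsMatching p → p a ≢ a → matched p ≡ 2 + matched (unlink p a)
  matched-unlink {p} {a} M pa≢a = ∑-raise₂ (pa≢a ∘ sym)
    (unmatched-at q a (unlink-fixes {p = p} (inj₁ refl)))
    (unmatched-at q (p a) (unlink-fixes {p = p} (inj₂ refl)))
    (matched-at p a pa≢a)
    (matched-at p (p a) (λ ppa≡pa → pa≢a (sym (trans (sym (involutive M a)) ppa≡pa))))
    (λ e e≢a e≢pa → cong (λ z → 𝟙 (¬? (z ≟ e))) (sym (unlink-other e≢a e≢pa)))
    where
    q : Fin k → Fin k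
    q = unlink p a

  -- Trade the matched pair {g, p g} for {x, g} and {y, p g} along the alternating path x g (p g) y.
  augment : ∀ {x y g} → IsMatching p → p x ≡ x → p y ≡ y → x ≢ y → p g ≢ g →
            x ~ g → y ~ p g → Enlargement p
  augment {p} {x} {y} {g} M px py x≢y pg≢g x~g y~h =
    link p₁ y h , link-isMatching M₁ p₁y p₁h y≢h y~h , enlarged
    where
    h : Fin k
    h = p g
    ph≢h : p h ≢ h
    ph≢h ph≡h = pg≢g (sym (trans (sym (involutive M g)) ph≡h))
    free≢moved : ∀ {z c} → p z ≡ z → p c ≢ c → z ≢ c
    free≢moved pz pc≢c refl = pc≢c pz
    x≢h : x ≢ h
    x≢h = free≢moved px ph≢h
    y≢h : y ≢ h
    y≢h = free≢moved py ph≢h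
    p₀ : Fin k → Fin k
    p₀ = unlink p g
    p₀-fixes : ∀ {z} → p z ≡ z → p₀ z ≡ z
    p₀-fixes pz = trans (unlink-other (free≢moved pz pg≢g) (free≢moved pz ph≢h)) pz
    p₀g : p₀ g ≡ g
    p₀g = unlink-fixes {p = p} (inj₁ refl)
    p₁ : Fin k → Fin k
    p₁ = link p₀ x g
    M₁ : IsMatching p₁
    M₁ = link-isMatching (unlink-isMatching M) (p₀-fixes px) p₀g (free≢moved px pg≢g) x~g
    p₁y : p₁ y ≡ y
    p₁y = trans (link-other (x≢y ∘ sym) (free≢moved py pg≢g)) (p₀-fixes py)
    p₁h : p₁ h ≡ h
    p₁h = trans (link-other (x≢h ∘ sym) (pg≢g)) (unlink-fixes {p = p} (inj₂ refl))
    enlarged : matched (link p₁ y h) ≡ 2 + matched p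
    enlarged = begin
      matched (link p₁ y h)  ≡⟨ matched-link p₁y p₁h y≢h ⟩
      2 + matched p₁         ≡⟨ cong (2 +_) (matched-link (p₀-fixes px) p₀g (free≢moved px pg≢g)) ⟩
      2 + (2 + matched p₀)   ≡⟨ cong (2 +_) (matched-unlink M pg≢g) ⟨
      2 + matched p          ∎
      where open ≡-Reasoning

module _ {n : ℕ} (H : Hypergraph n) where

  Disjoint : Fin (m H) → Fin (m H) → Set
  Disjoint e f = ¬ Meet H e f

  disjoint? : ∀ e f → Dec (Disjoint e f)
  disjoint? e f = ¬? (meet? H e f)

  meet-refl : ∀ e → Meet H e e
  meet-refl e = let (v , v∈e) = nonempty H e in v , x∈p∩q⁺ (v∈e , v∈e)

  disjoint-sym : ∀ {e f} → Disjoint e f → Disjoint f e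
  disjoint-sym {e} {f} e∩f=∅ f∩e≠∅ = e∩f=∅ (subst Nonempty (∩-comm (edge H f) (edge H e)) f∩e≠∅)

  -- An edge other than e and f that meets both is a common neighbour.
  avoiding-one-of : ∀ e f → m H ≤ commonNbrs H e f + sum (λ g → 𝟙 (disjoint? g e ⊎-dec disjoint? g f)) + 2
  avoiding-one-of e f = begin
    m H                                               ≡⟨ ∑-one (m H) ⟨
    sum {m H} (λ _ → 1)                               ≤⟨ ∑-mono covered ⟩
    sum (λ g → 𝟙 (common? g) + 𝟙 (avoids? g) + (𝟙 (g ≟ e) + 𝟙 (g ≟ f)))
      ≡⟨ ∑-distrib-+ (λ g → 𝟙 (common? g) + 𝟙 (avoids? g)) (λ g → 𝟙 (g ≟ e) + 𝟙 (g ≟ f)) ⟩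
    sum (λ g → 𝟙 (common? g) + 𝟙 (avoids? g)) + sum (λ g → 𝟙 (g ≟ e) + 𝟙 (g ≟ f))
      ≡⟨ cong₂ _+_ (∑-distrib-+ (λ g → 𝟙 (common? g)) (λ g → 𝟙 (avoids? g)))
                   (trans (∑-distrib-+ (λ g → 𝟙 (g ≟ e)) (λ g → 𝟙 (g ≟ f))) (cong₂ _+_ (∑-𝟙≟ e) (∑-𝟙≟ f))) ⟩
    sum (λ g → 𝟙 (common? g)) + sum (λ g → 𝟙 (avoids? g)) + 2
      ≡⟨ cong (λ c → c + sum (λ g → 𝟙 (avoids? g)) + 2) (count≡∑𝟙 common?) ⟨
    commonNbrs H e f + sum (λ g → 𝟙 (avoids? g)) + 2 ∎
    where
    open ℕ.≤-Reasoning
    common? : ∀ g → Dec (InN H e g × InN H f g)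
    common? g = inN? H e g ×-dec inN? H f g
    avoids? : ∀ g → Dec (Disjoint g e ⊎ Disjoint g f)
    avoids? g = disjoint? g e ⊎-dec disjoint? g f
    covered : ∀ g → 1 ≤ 𝟙 (common? g) + 𝟙 (avoids? g) + (𝟙 (g ≟ e) + 𝟙 (g ≟ f))
    covered g with g ≟ e | g ≟ f | meet? H g e | meet? H g f
    ... | yes _ | _     | _     | _     = ℕ.≤-trans (ℕ.m≤m+n 1 _) (ℕ.m≤n+m _ _)
    ... | no _  | yes _ | _     | _     = ℕ.m≤n+m 1 _
    ... | no _  | no _  | yes _ | yes _ = s≤s z≤n
    ... | no _  | no _  | yes _ | no _  = s≤s z≤n
    ... | no _  | no _  | no _  | _     = s≤s z≤n

-- Growing a matching

ascend : ∀ {X : Set ℓ₁} {Good : X → Set ℓ₂} (μ : X → ℕ) (bound : ℕ) → (∀ x → μ x ≤ bound) →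
         (∀ x → Dec (Good x)) → (∀ x → ¬ Good x → Σ[ y ∈ X ] μ x < μ y) → X → Σ X Good
ascend {X = X} {Good} μ bound μ≤bound good? improve x = go bound x (ℕ.m≤n+m bound (μ x))
  where
  go : ∀ fuel x → bound ≤ μ x + fuel → Σ X Good
  go fuel x enough with good? x
  ... | yes good = x , good
  ... | no bad   = next fuel enough (improve x bad)
    where
    next : ∀ fuel → bound ≤ μ x + fuel → Σ[ y ∈ X ] μ x < μ y → Σ X Good
    next zero    enough (y , μx<μy) = ⊥-elim (ℕ.<⇒≱ μx<μy
      (ℕ.≤-trans (μ≤bound y) (ℕ.≤-trans enough (ℕ.≤-reflexive (ℕ.+-identityʳ (μ x))))))
    next (suc f) enough (y , μx<μy) = go f y (ℕ.≤-trans enough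
      (ℕ.≤-trans (ℕ.≤-reflexive (ℕ.+-suc (μ x) f)) (ℕ.+-monoˡ-≤ f μx<μy)))

orbits-bound : ∀ {O W S k n} → O + O + W ≡ k + k → 6 * k ≤ S + 6 * n → S + S ≤ 6 * W → O ≤ n
orbits-bound {O} {W} {S} {k} {n} double lower upper =
  ℕ.*-cancelˡ-≤ 12 (ℕ.+-cancelʳ-≤ (6 * W) (12 * O) (12 * n) (begin
    12 * O + 6 * W            ≡⟨ e₀ O W ⟩
    6 * (O + O + W)           ≡⟨ cong (6 *_) double ⟩
    6 * (k + k)               ≡⟨ ℕ.*-distribˡ-+ 6 k k ⟩
    6 * k + 6 * k             ≤⟨ ℕ.+-mono-≤ lower lower ⟩
    S + 6 * n + (S + 6 * n)   ≡⟨ e₁ S n ⟩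
    S + S + 12 * n            ≤⟨ ℕ.+-monoˡ-≤ (12 * n) upper ⟩
    6 * W + 12 * n            ≡⟨ ℕ.+-comm (6 * W) _ ⟩
    12 * n + 6 * W            ∎))
  where
  open ℕ.≤-Reasoning
  e₀ : ∀ O W → 12 * O + 6 * W ≡ 6 * (O + O + W)
  e₀ = solve-∀
  e₁ : ∀ S n → S + 6 * n + (S + 6 * n) ≡ S + S + 12 * n
  e₁ = solve-∀

enough-free : ∀ {O W F k n a} → n < O → O + O + W ≡ k + k → 4 * k ≤ a + 4 * n → a ≤ F + W → 4 ≤ F
enough-free {O} {W} {F} {k} {n} {a} n<O double large a≤ =
  ℕ.≤-trans (ℕ.m≤m+n 4 W) (ℕ.+-cancelʳ-≤ (W + 4 * n) (4 + W) F (begin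
    4 + W + (W + 4 * n)     ≡⟨ e₀ n W ⟩
    4 * suc n + 2 * W       ≤⟨ ℕ.+-monoˡ-≤ (2 * W) (ℕ.*-monoʳ-≤ 4 n<O) ⟩
    4 * O + 2 * W           ≡⟨ e₁ O W ⟩
    2 * (O + O + W)         ≡⟨ cong (2 *_) double ⟩
    2 * (k + k)             ≡⟨ e₂ k ⟩
    4 * k                   ≤⟨ large ⟩
    a + 4 * n               ≤⟨ ℕ.+-monoˡ-≤ (4 * n) a≤ ⟩
    F + W + 4 * n           ≡⟨ ℕ.+-assoc F W _ ⟩
    F + (W + 4 * n)         ∎))
  where
  open ℕ.≤-Reasoning
  e₀ : ∀ n W → 4 + W + (W + 4 * n) ≡ 4 * suc n + 2 * W
  e₀ = solve-∀
  e₁ : ∀ O W → 4 * O + 2 * W ≡ 2 * (O + O + W)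
  e₁ = solve-∀
  e₂ : ∀ k → 2 * (k + k) ≡ 4 * k
  e₂ = solve-∀

module _ {n : ℕ} (H : Hypergraph n) (A : Subset (m H))
         (A-large : 4 * m H ≤ ∣ A ∣ + 4 * n)
         (A-useful : ∀ e f → e ∈ A → f ∈ A → e ≢ f → Meet H e f → Useful H e f) where

  open Matching (Disjoint H) (disjoint-sym H)

  free∈A? : (p : Fin (m H) → Fin (m H)) → Decidable (λ e → e ∈ A × p e ≡ e)
  free∈A? p e = (e ∈? A) ×-dec (p e ≟ e)

  ∣A∣≤free∈A+matched : ∀ p → ∣ A ∣ ≤ count (free∈A? p) + matched p
  ∣A∣≤free∈A+matched p = begin
    ∣ A ∣                                            ≡⟨ ∣p∣≡∑𝟙 A ⟩
    sum (λ e → 𝟙 (e ∈? A))                           ≤⟨ ∑-mono (λ e → 𝟙≤𝟙×+𝟙¬ (e ∈? A) (p e ≟ e)) ⟩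
    sum (λ e → 𝟙 (free∈A? p e) + 𝟙 (¬? (p e ≟ e)))   ≡⟨ ∑-distrib-+ (λ e → 𝟙 (free∈A? p e)) _ ⟩
    sum (λ e → 𝟙 (free∈A? p e)) + matched p          ≡⟨ cong (_+ matched p) (count≡∑𝟙 (free∈A? p)) ⟨
    count (free∈A? p) + matched p                    ∎
    where open ℕ.≤-Reasoning

  module NoImprovement {p} (M : IsMatching p) (x : Fin 4 → Fin (m H))
    (x∈A : ∀ i → x i ∈ A) (x-free : ∀ i → p (x i) ≡ x i) (x-distinct : ∀ {i j} → i ≢ j → x i ≢ x j)
    (no-extension : ∀ g i → p g ≡ g → ¬ Disjoint H g (x i))
    (no-augmentation : ∀ g i j → i ≢ j → Disjoint H g (x i) → Disjoint H (p g) (x j) → ⊥) where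

    hits : Fin (m H) → ℕ
    hits g = pairsMeeting (λ i → disjoint? H g (x i))

    avoiders : Fin 6 → ℕ
    avoiders t = sum λ g → 𝟙 (pairMeets? (λ i → disjoint? H g (x i)) t)

    avoiders-many : ∀ t → m H ≤ avoiders t + n
    avoiders-many t = begin
      m H                                       ≤⟨ avoiding-one-of H (x i) (x j) ⟩
      commonNbrs H (x i) (x j) + avoiders t + 2  ≡⟨ rearrange (commonNbrs H (x i) (x j)) (avoiders t) ⟩
      avoiders t + (commonNbrs H (x i) (x j) + 2) ≤⟨ ℕ.+-monoʳ-≤ (avoiders t) (proj₂ (proj₂ useful)) ⟩
      avoiders t + n                            ∎
      where
      open ℕ.≤-Reasoning
      i j : Fin 4
      i = proj₁ (pair t)
      j = proj₂ (pair t)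
      x-meet : Meet H (x i) (x j)
      x-meet = decidable-stable (meet? H (x i) (x j)) (no-extension (x i) j (x-free i))
      useful : Useful H (x i) (x j)
      useful = A-useful (x i) (x j) (x∈A i) (x∈A j) (x-distinct (pair-distinct t)) x-meet
      rearrange : ∀ c a → c + a + 2 ≡ a + (c + 2)
      rearrange = solve-∀

    hits-lower : 6 * m H ≤ sum hits + 6 * n
    hits-lower = begin
      6 * m H                          ≡⟨ ∑-const 6 (m H) ⟨
      sum {6} (λ _ → m H)              ≤⟨ ∑-mono avoiders-many ⟩
      sum (λ t → avoiders t + n)       ≡⟨ ∑-distrib-+ avoiders (λ _ → n) ⟩
      sum avoiders + sum {6} (λ _ → n) ≡⟨ cong₂ _+_ (∑-comm (λ g t → 𝟙 (pairMeets? (λ i → disjoint? H g (x i)) t))) (∑-const 6 n) ⟨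
      sum hits + 6 * n                 ∎
      where open ℕ.≤-Reasoning

    hits-upper : sum hits + sum hits ≤ 6 * matched p
    hits-upper = begin
      sum hits + sum hits                   ≡⟨ cong (sum hits +_) (∑-∘-involution (involutive M) hits) ⟨
      sum hits + sum (hits ∘ p)             ≡⟨ ∑-distrib-+ hits (hits ∘ p) ⟨
      sum (λ g → hits g + hits (p g))       ≤⟨ ∑-mono matched-pair ⟩
      sum (λ g → 6 * 𝟙 (¬? (p g ≟ g)))      ≡⟨ *-distribˡ-sum 6 (λ g → 𝟙 (¬? (p g ≟ g))) ⟨
      6 * matched p                         ∎
      where
      open ℕ.≤-Reasoning
      matched-pair : ∀ g → hits g + hits (p g) ≤ 6 * 𝟙 (¬? (p g ≟ g))
      matched-pair g with p g ≟ g
      ... | yes pg≡g = ℕ.≤-reflexive (cong₂ _+_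
        (pairsMeeting-empty (λ i → disjoint? H g (x i)) (λ i → no-extension g i pg≡g))
        (pairsMeeting-empty (λ i → disjoint? H (p g) (x i)) (λ i → no-extension (p g) i (cong p pg≡g))))
      ... | no _     = pairsMeeting-noCross (λ i → disjoint? H g (x i)) (λ j → disjoint? H (p g) (x j))
                                            (no-augmentation g)

    few-orbits : orbits p ≤ n
    few-orbits = orbits-bound {S = sum hits} {k = m H} (orbits-double (involutive M)) hits-lower hits-upper

  improve : ∀ {p} → IsMatching p → n < orbits p → Enlargement p
  improve {p} M many-orbits = by-cases (any? λ g → any? λ i → (p g ≟ g) ×-dec disjoint? H g (x i))
    (any? λ g → any? λ i → any? λ j → ¬? (i ≟ j) ×-dec (disjoint? H g (x i) ×-dec disjoint? H (p g) (x j)))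
    where
    four-free : Σ[ x ∈ (Fin 4 → Fin (m H)) ] ((∀ i → x i ∈ A × p (x i) ≡ x i) × (∀ i j → x i ≡ x j → i ≡ j))
    four-free = distinct-witnesses (free∈A? p)
      (enough-free {k = m H} many-orbits (orbits-double (involutive M)) A-large (∣A∣≤free∈A+matched p))

    x : Fin 4 → Fin (m H)
    x = proj₁ four-free
    x∈A : ∀ i → x i ∈ A
    x∈A i = proj₁ (proj₁ (proj₂ four-free) i)
    x-free : ∀ i → p (x i) ≡ x i
    x-free i = proj₂ (proj₁ (proj₂ four-free) i)
    x-distinct : ∀ {i j} → i ≢ j → x i ≢ x j
    x-distinct i≢j = i≢j ∘ proj₂ (proj₂ four-free) _ _

    by-cases : Dec (∃ λ g → ∃ λ i → p g ≡ g × Disjoint H g (x i)) →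
               Dec (∃ λ g → ∃ λ i → ∃ λ j → i ≢ j × Disjoint H g (x i) × Disjoint H (p g) (x j)) →
               Enlargement p
    by-cases (yes (g , i , pg≡g , g∩xi=∅)) _ =
      extend M (x-free i) pg≡g (λ { refl → g∩xi=∅ (meet-refl H g) }) (disjoint-sym H g∩xi=∅)
    by-cases (no no-extension) (yes (g , i , j , i≢j , g∩xi=∅ , pg∩xj=∅)) =
      augment M (x-free i) (x-free j) (x-distinct i≢j)
        (λ pg≡g → no-extension (g , i , pg≡g , g∩xi=∅)) (disjoint-sym H g∩xi=∅) (disjoint-sym H pg∩xj=∅)
    by-cases (no no-extension) (no no-augmentation) = ⊥-elim (ℕ.<⇒≱ many-orbits
      (NoImprovement.few-orbits M x x∈A x-free x-distinct
        (λ g i pg≡g g∩xi=∅ → no-extension (g , i , pg≡g , g∩xi=∅))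
        (λ g i j i≢j g∩xi=∅ pg∩xj=∅ → no-augmentation (g , i , j , i≢j , g∩xi=∅ , pg∩xj=∅))))

  matching-with-few-orbits : Σ[ p ∈ (Fin (m H) → Fin (m H)) ] (IsMatching p × orbits p ≤ n)
  matching-with-few-orbits = proj₁ (proj₁ found) , proj₂ (proj₁ found) , proj₂ found
    where
    Matchings : Set
    Matchings = Σ (Fin (m H) → Fin (m H)) IsMatching
    step : ∀ ((p , M) : Matchings) → ¬ orbits p ≤ n → Σ[ (q , _) ∈ Matchings ] matched p < matched q
    step (p , M) many = let (q , Mq , enlarged) = improve M (ℕ.≰⇒> many) in
      (q , Mq) , subst (matched p <_) (sym enlarged) (ℕ.≤-trans (ℕ.n<1+n _) (ℕ.n≤1+n _))
    found : Σ[ (p , _) ∈ Matchings ] orbits p ≤ n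
    found = ascend (matched ∘ proj₁) (m H) (matched≤k ∘ proj₁) (λ (p , _) → orbits p ℕ.≤? n) step
      ((λ e → e) , id-isMatching)

module _ {n : ℕ} (H : Hypergraph n) {p : Fin (m H) → Fin (m H)} {c : Fin (m H) → Fin n}
         (same-colour : ∀ e f → c e ≡ c f → f ≡ e ⊎ f ≡ p e) where

  proper-colouring : (∀ e → p e ≢ e → Disjoint H e (p e)) → ProperColouring H c
  proper-colouring partner-disjoint e f e≢f e∩f≠∅ ce≡cf with same-colour e f ce≡cf
  ... | inj₁ f≡e = e≢f (sym f≡e)
  ... | inj₂ refl = partner-disjoint e (e≢f ∘ sym) e∩f≠∅

  at-most-two-per-colour : AtMostTwoPerColour H c
  at-most-two-per-colour k = subst (_≤ 2) (sym (count≡∑𝟙 (λ e → c e ≟ k))) (by-cases (any? λ e → c e ≟ k))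
    where
    by-cases : Dec (∃ λ e → c e ≡ k) → sum (λ e → 𝟙 (c e ≟ k)) ≤ 2
    by-cases (yes (e , ce≡k)) = ∑-𝟙≤2 (λ f → c f ≟ k) (λ f cf≡k → same-colour e f (trans ce≡k (sym cf≡k)))
    by-cases (no ∄e)          = ℕ.≤-trans (ℕ.≤-reflexive (∑-𝟙-empty (λ f → c f ≟ k) (λ f cf≡k → ∄e (f , cf≡k)))) z≤n

proposition5p4 : (n : ℕ) (H : Hypergraph n) → Linear H
    → (A : Subset (m H))
    → 4 * m H ≤ ∣ A ∣ + 4 * n
    → (∀ e f → e ∈ A → f ∈ A → e ≢ f → Meet H e f → Useful H e f)
    → Σ (Fin (m H) → Fin n) (λ c → ProperColouring H c × AtMostTwoPerColour H c)
proposition5p4 n H _ A A-large A-useful = colouring (matching-with-few-orbits H A A-large A-useful)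
  where
  open Matching (Disjoint H) (disjoint-sym H)
  colouring : Σ[ p ∈ (Fin (m H) → Fin (m H)) ] (IsMatching p × orbits p ≤ n) →
              Σ (Fin (m H) → Fin n) (λ c → ProperColouring H c × AtMostTwoPerColour H c)
  colouring (p , M , few) = let (c , same-colour) = orbit-colouring (involutive M) few in
    c , proper-colouring H same-colour (compatible M) , at-most-two-per-colour H same-colour
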